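{- Let $p$ be a prime and $\mathcal H$ a finite relational structure. If a relation $R$ is $p$-mpp-definable in $\mathcal H$, then $R$ is also strictly $p$-mpp-definable in $\mathcal H$.
   Context: Let $H$ be the base set of $\mathcal H$. A $p$-modular primitive-positive formula is $\exists^{\oplus p} y_1\dots y_s\,\Phi(x_1,\dots,x_k,y_1,\dots,y_s)$ where $\Phi$ is a conjunction of atoms that are either equalities $z_1=z_2$ or $Q(z_1,\dots,z_\ell)$ with $Q$ a relation of $\mathcal H$. It defines the relation $R$ with $R(a_1,\dots,a_k)$ true iff the number $\#\mathrm{ext}_\Phi(\mathbf a)$ of tuples $\mathbf b\in H^s$ with $\Phi(\mathbf a,\mathbf b)$ true is not divisible by $p$; $R$ is then $p$-mpp-definable in $\mathcal H$. The definition is strict if moreover $\#\mathrm{ext}_\Phi(\mathbf a)\equiv 1\pmod p$ for every $\mathbf a$ with $R(\mathbf a)$ true; then $R$ is strictly $p$-mpp-definable. -}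

module Defs where

open import Data.Nat using (ℕ; zero; suc; _+_; _*_)
open import Data.Nat.Divisibility using (_∣_)
open import Data.Fin using (Fin; _≟_)
open import Data.Fin.Base using ()
open import Data.Vec using (Vec; []; _∷_; _++_; lookup)
open import Data.List using (List; []; _∷_; map; allFin)
open import Data.Nat.ListAction using (sum)
open import Data.Bool using (Bool; true; false; if_then_else_; _∧_)
open import Data.Product using (Σ; ∃; _×_; _,_)
open import Relation.Nullary using (¬_)
open import Relation.Nullary.Decidable using (⌊_⌋)
open import Function.Bundles using (_⇔_)
open import Relation.Binary.PropositionalEquality using (_≡_)

record Structure : Set where
  field
    size  : ℕ
    nrels : ℕ
    arity : Fin nrels → ℕ
    rel   : (i : Fin nrels) → Vec (Fin size) (arity i) → Bool

open Structure public

Relation : Structure → ℕ → Set₁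
Relation H k = Vec (Fin (size H)) k → Set

-- Atomic formulas over variables Fin v (v = k + s : free variables x first,
-- then quantified variables y).
data Atom (H : Structure) (v : ℕ) : Set where
  eq  : Fin v → Fin v → Atom H v
  app : (i : Fin (nrels H)) → Vec (Fin v) (arity H i) → Atom H v

record MPPFormula (H : Structure) (k : ℕ) : Set where
  field
    s   : ℕ
    Φ   : List (Atom H (k + s))

open MPPFormula public

evalAtom : {H : Structure} {v : ℕ} → Vec (Fin (size H)) v → Atom H v → Bool
evalAtom ρ (eq z₁ z₂)     = ⌊ lookup ρ z₁ ≟ lookup ρ z₂ ⌋
evalAtom {H} ρ (app i zs) = rel H i (Data.Vec.map (lookup ρ) zs)

evalConj : {H : Structure} {v : ℕ} → Vec (Fin (size H)) v → List (Atom H v) → Bool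
evalConj ρ []       = true
evalConj ρ (α ∷ αs) = evalAtom ρ α ∧ evalConj ρ αs

countTrue : (n s : ℕ) → (Vec (Fin n) s → Bool) → ℕ
countTrue n zero    f = if f [] then 1 else 0
countTrue n (suc s) f = sum (map (λ i → countTrue n s (λ b → f (i ∷ b))) (allFin n))

numExt : {H : Structure} {k : ℕ} → MPPFormula H k → Vec (Fin (size H)) k → ℕ
numExt {H} φ a = countTrue (size H) (s φ) (λ b → evalConj (a ++ b) (Φ φ))

Defines : (p : ℕ) {H : Structure} {k : ℕ} → MPPFormula H k → Relation H k → Set
Defines p φ R = ∀ a → R a ⇔ (¬ (p ∣ numExt φ a))

MPPDefinable : (p : ℕ) (H : Structure) {k : ℕ} → Relation H k → Set
MPPDefinable p H {k} R = Σ (MPPFormula H k) λ φ → Defines p φ R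

StrictlyMPPDefinable : (p : ℕ) (H : Structure) {k : ℕ} → Relation H k → Set
StrictlyMPPDefinable p H {k} R =
  Σ (MPPFormula H k) λ φ →
    Defines p φ R × (∀ a → R a → ∃ λ q → numExt φ a ≡ 1 + q * p)

{-# OPTIONS --safe #-}
-- Conjoining m copies of a formula, each with its own quantified variables, raises every count
-- #ext(a) to the m-th power. A multiple of p stays a multiple of p, while a count N prime to p
-- satisfies N^d ≡ 1 (mod p) for some 1 ≤ d ≤ p, hence N^(p!) ≡ 1 (mod p). So the p!-th power of a
-- formula defining R still defines R, and now strictly.
module Submission where

open import Defs
open import Data.Nat using (ℕ)
open import Data.Nat.Primality using (Prime)
open import Data.Bool using (Bool; true; false; _∧_)
open import Data.Bool.Properties using (∧-assoc)
open import Data.Fin using (Fin; toℕ)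
open import Data.Fin.Properties using (pigeonhole; toℕ-fromℕ<; toℕ<n)
open import Data.List as List using (List; allFin)
import Data.List.Properties as Listₚ
open import Data.Nat using (zero; suc; _+_; _*_; _∸_; _^_; _≤_; _<_; s≤s⁻¹; NonZero; NonTrivial; _!)
open import Data.Nat.Base using (nonTrivial⇒≢1)
open import Data.Nat.DivMod using (_%_; _/_; _mod_; m≡m%n+[m/n]*n; m%n<n)
open import Data.Nat.Divisibility
open import Data.Nat.ListAction using (sum)
open import Data.Nat.Primality using (euclidsLemma; prime⇒nonZero; prime⇒nonTrivial)
open import Data.Nat.Properties
open import Data.Nat.Solver using (module +-*-Solver)
open import Data.Product using (∃; _×_; _,_)
open import Data.Sum using (inj₁; inj₂)
open import Data.Vec as Vec using (Vec; []; _∷_; _++_; lookup; take; drop)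
open import Data.Vec.Properties using (take-map; drop-map; lookup-map; map-∘; map-cong; map-lookup-allFin)
open import Function.Bundles using (mk⇔; Equivalence)
open import Relation.Nullary using (¬_; contradiction)
open import Function.Base using (_∘_)
open import Relation.Binary.PropositionalEquality

private variable
  A B : Set

sum-map-0 : (xs : List A) → sum (List.map (λ _ → 0) xs) ≡ 0
sum-map-0 List.[]       = refl
sum-map-0 (_ List.∷ xs) = sum-map-0 xs

sum-map-*ʳ : (f : A → ℕ) (c : ℕ) (xs : List A) →
  sum (List.map (λ x → f x * c) xs) ≡ sum (List.map f xs) * c
sum-map-*ʳ f c List.[]       = refl
sum-map-*ʳ f c (x List.∷ xs) =
  trans (cong (f x * c +_) (sum-map-*ʳ f c xs)) (sym (*-distribʳ-+ c (f x) _))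

countTrue-cong : ∀ n s {f g : Vec (Fin n) s → Bool} → (∀ b → f b ≡ g b) →
  countTrue n s f ≡ countTrue n s g
countTrue-cong n zero    f≗g rewrite f≗g [] = refl
countTrue-cong n (suc s) f≗g =
  cong sum (Listₚ.map-cong (λ i → countTrue-cong n s (λ b → f≗g (i ∷ b))) (allFin n))

countTrue-false : ∀ n s {f : Vec (Fin n) s → Bool} → (∀ b → f b ≡ false) →
  countTrue n s f ≡ 0
countTrue-false n zero    f≗false rewrite f≗false [] = refl
countTrue-false n (suc s) f≗false =
  trans (cong sum (Listₚ.map-cong (λ i → countTrue-false n s (λ b → f≗false (i ∷ b))) (allFin n)))
        (sum-map-0 (allFin n))

countTrue-++-∧ : ∀ n s t {h : Vec (Fin n) (s + t) → Bool} {f g} →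
  (∀ b c → h (b ++ c) ≡ f b ∧ g c) →
  countTrue n (s + t) h ≡ countTrue n s f * countTrue n t g
countTrue-++-∧ n zero t {f = f} {g} h≗f∧g with f [] in f[]
... | true  = trans (countTrue-cong n t (λ c → trans (h≗f∧g [] c) (cong (_∧ g c) f[])))
                    (sym (+-identityʳ _))
... | false = countTrue-false n t (λ c → trans (h≗f∧g [] c) (cong (_∧ g c) f[]))
countTrue-++-∧ n (suc s) t {f = f} {g} h≗f∧g =
  trans (cong sum (Listₚ.map-cong (λ i → countTrue-++-∧ n s t (λ b c → h≗f∧g (i ∷ b) c))
                                   (allFin n)))
        (sum-map-*ʳ (λ i → countTrue n s (λ b → f (i ∷ b))) (countTrue n t g) (allFin n))

withoutLast : ∀ k m {n} → Vec A (k + (m + n)) → Vec A (k + m)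
withoutLast zero    m xs       = take m xs
withoutLast (suc k) m (x ∷ xs) = x ∷ withoutLast k m xs

withoutMiddle : ∀ k m {n} → Vec A (k + (m + n)) → Vec A (k + n)
withoutMiddle zero    m xs       = drop m xs
withoutMiddle (suc k) m (x ∷ xs) = x ∷ withoutMiddle k m xs

take-++ : ∀ {m n} (xs : Vec A m) (ys : Vec A n) → take m (xs ++ ys) ≡ xs
take-++ []       ys = refl
take-++ (x ∷ xs) ys = cong (x ∷_) (take-++ xs ys)

drop-++ : ∀ {m n} (xs : Vec A m) (ys : Vec A n) → drop m (xs ++ ys) ≡ ys
drop-++ []       ys = refl
drop-++ (x ∷ xs) ys = drop-++ xs ys

withoutLast-++ : ∀ {k m n} (xs : Vec A k) (ys : Vec A m) (zs : Vec A n) →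
  withoutLast k m (xs ++ (ys ++ zs)) ≡ xs ++ ys
withoutLast-++ []       ys zs = take-++ ys zs
withoutLast-++ (x ∷ xs) ys zs = cong (x ∷_) (withoutLast-++ xs ys zs)

withoutMiddle-++ : ∀ {k m n} (xs : Vec A k) (ys : Vec A m) (zs : Vec A n) →
  withoutMiddle k m (xs ++ (ys ++ zs)) ≡ xs ++ zs
withoutMiddle-++ []       ys zs = drop-++ ys zs
withoutMiddle-++ (x ∷ xs) ys zs = cong (x ∷_) (withoutMiddle-++ xs ys zs)

withoutLast-map : (f : A → B) (k m : ℕ) {n : ℕ} (xs : Vec A (k + (m + n))) →
  withoutLast k m (Vec.map f xs) ≡ Vec.map f (withoutLast k m xs)
withoutLast-map f zero    m xs       = take-map f m xs
withoutLast-map f (suc k) m (x ∷ xs) = cong (f x ∷_) (withoutLast-map f k m xs)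

withoutMiddle-map : (f : A → B) (k m : ℕ) {n : ℕ} (xs : Vec A (k + (m + n))) →
  withoutMiddle k m (Vec.map f xs) ≡ Vec.map f (withoutMiddle k m xs)
withoutMiddle-map f zero    m xs       = drop-map f m xs
withoutMiddle-map f (suc k) m (x ∷ xs) = cong (f x ∷_) (withoutMiddle-map f k m xs)

map-lookup-withoutLast-allFin : ∀ k m {n} (ρ : Vec A (k + (m + n))) →
  Vec.map (lookup ρ) (withoutLast k m (Vec.allFin _)) ≡ withoutLast k m ρ
map-lookup-withoutLast-allFin k m ρ =
  trans (sym (withoutLast-map (lookup ρ) k m (Vec.allFin _)))
        (cong (withoutLast k m) (map-lookup-allFin ρ))

map-lookup-withoutMiddle-allFin : ∀ k m {n} (ρ : Vec A (k + (m + n))) →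
  Vec.map (lookup ρ) (withoutMiddle k m (Vec.allFin _)) ≡ withoutMiddle k m ρ
map-lookup-withoutMiddle-allFin k m ρ =
  trans (sym (withoutMiddle-map (lookup ρ) k m (Vec.allFin _)))
        (cong (withoutMiddle k m) (map-lookup-allFin ρ))

rename : {H : Structure} {v w : ℕ} → Vec (Fin w) v → Atom H v → Atom H w
rename σ (eq z₁ z₂) = eq (lookup σ z₁) (lookup σ z₂)
rename σ (app i zs) = app i (Vec.map (lookup σ) zs)

evalAtom-rename : {H : Structure} {v w : ℕ} (ρ : Vec (Fin (size H)) w) (σ : Vec (Fin w) v)
  (α : Atom H v) → evalAtom ρ (rename σ α) ≡ evalAtom (Vec.map (lookup ρ) σ) α
evalAtom-rename ρ σ (eq z₁ z₂)
  rewrite lookup-map z₁ (lookup ρ) σ | lookup-map z₂ (lookup ρ) σ = refl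
evalAtom-rename {H} ρ σ (app i zs) = cong (rel H i) (begin
  Vec.map (lookup ρ) (Vec.map (lookup σ) zs)        ≡⟨ map-∘ (lookup ρ) (lookup σ) zs ⟨
  Vec.map (lookup ρ ∘ lookup σ) zs                   ≡⟨ map-cong (λ z → lookup-map z (lookup ρ) σ) zs ⟨
  Vec.map (lookup (Vec.map (lookup ρ) σ)) zs         ∎)
  where open ≡-Reasoning

evalConj-rename : {H : Structure} {v w : ℕ} (ρ : Vec (Fin (size H)) w) (σ : Vec (Fin w) v)
  (αs : List (Atom H v)) → evalConj ρ (List.map (rename σ) αs) ≡ evalConj (Vec.map (lookup ρ) σ) αs
evalConj-rename ρ σ List.[]       = refl
evalConj-rename ρ σ (α List.∷ αs) = cong₂ _∧_ (evalAtom-rename ρ σ α) (evalConj-rename ρ σ αs)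

evalConj-++ : {H : Structure} {v : ℕ} (ρ : Vec (Fin (size H)) v) (αs βs : List (Atom H v)) →
  evalConj ρ (αs List.++ βs) ≡ evalConj ρ αs ∧ evalConj ρ βs
evalConj-++ ρ List.[]       βs = refl
evalConj-++ ρ (α List.∷ αs) βs =
  trans (cong (evalAtom ρ α ∧_) (evalConj-++ ρ αs βs)) (sym (∧-assoc (evalAtom ρ α) _ _))

infixr 6 _∧ᶠ_
infixr 8 _^ᶠ_

_∧ᶠ_ : {H : Structure} {k : ℕ} → MPPFormula H k → MPPFormula H k → MPPFormula H k
_∧ᶠ_ {k = k} φ ψ = record
  { s = s φ + s ψ
  ; Φ = List.map (rename (withoutLast k (s φ) (Vec.allFin _))) (Φ φ)
          List.++ List.map (rename (withoutMiddle k (s φ) (Vec.allFin _))) (Φ ψ)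
  }

numExt-∧ᶠ : {H : Structure} {k : ℕ} (φ ψ : MPPFormula H k) (a : Vec (Fin (size H)) k) →
  numExt (φ ∧ᶠ ψ) a ≡ numExt φ a * numExt ψ a
numExt-∧ᶠ {H} {k} φ ψ a = countTrue-++-∧ (size H) (s φ) (s ψ) evalConj-split
  where
  σ₁ : Vec (Fin (k + (s φ + s ψ))) (k + s φ)
  σ₁ = withoutLast k (s φ) (Vec.allFin _)
  σ₂ : Vec (Fin (k + (s φ + s ψ))) (k + s ψ)
  σ₂ = withoutMiddle k (s φ) (Vec.allFin _)
  evalConj-split : ∀ b c →
    evalConj (a ++ (b ++ c)) (Φ (φ ∧ᶠ ψ)) ≡ evalConj (a ++ b) (Φ φ) ∧ evalConj (a ++ c) (Φ ψ)
  evalConj-split b c = begin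
    evalConj ρ (List.map (rename σ₁) (Φ φ) List.++ List.map (rename σ₂) (Φ ψ))
      ≡⟨ evalConj-++ ρ (List.map (rename σ₁) (Φ φ)) (List.map (rename σ₂) (Φ ψ)) ⟩
    evalConj ρ (List.map (rename σ₁) (Φ φ)) ∧ evalConj ρ (List.map (rename σ₂) (Φ ψ))
      ≡⟨ cong₂ _∧_ (evalConj-rename ρ σ₁ (Φ φ)) (evalConj-rename ρ σ₂ (Φ ψ)) ⟩
    evalConj (Vec.map (lookup ρ) σ₁) (Φ φ) ∧ evalConj (Vec.map (lookup ρ) σ₂) (Φ ψ)
      ≡⟨ cong₂ (λ ρ₁ ρ₂ → evalConj ρ₁ (Φ φ) ∧ evalConj ρ₂ (Φ ψ))
               (trans (map-lookup-withoutLast-allFin k (s φ) ρ) (withoutLast-++ a b c))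
               (trans (map-lookup-withoutMiddle-allFin k (s φ) ρ) (withoutMiddle-++ a b c)) ⟩
    evalConj (a ++ b) (Φ φ) ∧ evalConj (a ++ c) (Φ ψ)
      ∎
    where
    open ≡-Reasoning
    ρ : Vec (Fin (size H)) (k + (s φ + s ψ))
    ρ = a ++ (b ++ c)

⊤ᶠ : {H : Structure} {k : ℕ} → MPPFormula H k
⊤ᶠ = record { s = 0 ; Φ = List.[] }

_^ᶠ_ : {H : Structure} {k : ℕ} → MPPFormula H k → ℕ → MPPFormula H k
φ ^ᶠ zero  = ⊤ᶠ
φ ^ᶠ suc m = φ ∧ᶠ φ ^ᶠ m

numExt-^ᶠ : {H : Structure} {k : ℕ} (φ : MPPFormula H k) (m : ℕ) (a : Vec (Fin (size H)) k) →
  numExt (φ ^ᶠ m) a ≡ numExt φ a ^ m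
numExt-^ᶠ φ zero    a = refl
numExt-^ᶠ φ (suc m) a = trans (numExt-∧ᶠ φ (φ ^ᶠ m) a) (cong (numExt φ a *_) (numExt-^ᶠ φ m a))

infix 4 _≡1mod_

_≡1mod_ : ℕ → ℕ → Set
y ≡1mod p = ∃ λ q → y ≡ 1 + q * p

≡1mod-* : ∀ {p x y} → x ≡1mod p → y ≡1mod p → x * y ≡1mod p
≡1mod-* {p} (a , refl) (b , refl) = b + a * (1 + b * p) , solve 3
  (λ a b p → (con 1 :+ a :* p) :* (con 1 :+ b :* p) := con 1 :+ (b :+ a :* (con 1 :+ b :* p)) :* p)
  refl a b p
  where open +-*-Solver

≡1mod-^ : ∀ {p y} n → y ≡1mod p → y ^ n ≡1mod p
≡1mod-^ zero    _   = 0 , refl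
≡1mod-^ (suc n) y≡1 = ≡1mod-* y≡1 (≡1mod-^ n y≡1)

≡1mod⇒∤ : ∀ {p y} .{{_ : NonTrivial p}} → y ≡1mod p → ¬ p ∣ y
≡1mod⇒∤ {p} (q , refl) p∣y =
  nonTrivial⇒≢1 (∣1⇒≡1 (∣m+n∣m⇒∣n (subst (p ∣_) (+-comm 1 (q * p)) p∣y) (n∣m*n q)))

∤⇒∤^ : ∀ {p m} n → Prime p → ¬ p ∣ m → ¬ p ∣ m ^ n
∤⇒∤^ zero    p-prime _   = ≡1mod⇒∤ {{prime⇒nonTrivial p-prime}} (0 , refl)
∤⇒∤^ {m = m} (suc n) p-prime p∤m p∣mᵐ with euclidsLemma m (m ^ n) p-prime p∣mᵐ
... | inj₁ p∣m  = p∤m p∣m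
... | inj₂ p∣mⁿ = ∤⇒∤^ n p-prime p∤m p∣mⁿ

%≡%⇒∣∸ : ∀ p {a b} .{{_ : NonZero p}} → a % p ≡ b % p → p ∣ b ∸ a
%≡%⇒∣∸ p {a} {b} a%p≡b%p = divides (b / p ∸ a / p) (begin
  b ∸ a
    ≡⟨ cong₂ _∸_ (m≡m%n+[m/n]*n b p) (m≡m%n+[m/n]*n a p) ⟩
  (b % p + b / p * p) ∸ (a % p + a / p * p)
    ≡⟨ cong (λ r → (b % p + b / p * p) ∸ (r + a / p * p)) a%p≡b%p ⟩
  (b % p + b / p * p) ∸ (b % p + a / p * p)
    ≡⟨ [m+n]∸[m+o]≡n∸o (b % p) _ _ ⟩
  b / p * p ∸ a / p * p
    ≡⟨ *-distribʳ-∸ p (b / p) (a / p) ⟨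
  (b / p ∸ a / p) * p
    ∎)
  where open ≡-Reasoning

%-cancelˡ-≡1mod : ∀ {p} x y .{{_ : NonZero p}} → Prime p → ¬ p ∣ x →
  x % p ≡ (x * y) % p → y ≡1mod p
%-cancelˡ-≡1mod {p} x zero    _       p∤x x%p≡0 =
  contradiction (%≡%⇒∣∸ p (sym (trans x%p≡0 (cong (_% p) (*-zeroʳ x))))) p∤x
%-cancelˡ-≡1mod {p} x (suc y) p-prime p∤x x%p≡xy%p
  with euclidsLemma x y p-prime (subst (p ∣_) x*[1+y]∸x≡x*y (%≡%⇒∣∸ p x%p≡xy%p))
  where
  x*[1+y]∸x≡x*y : x * suc y ∸ x ≡ x * y
  x*[1+y]∸x≡x*y = trans (cong (_∸ x) (*-suc x y)) (m+n∸m≡n x (x * y))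
... | inj₁ p∣x            = contradiction p∣x p∤x
... | inj₂ (divides q y≡) = q , cong suc y≡

-- Pigeonhole on the residues of N⁰, …, Nᵖ gives Nⁱ ≡ Nʲ (mod p) with i < j ≤ p, and Nⁱ cancels.
∃[d≤p]N^d≡1mod : ∀ {p} N .{{_ : NonZero p}} → Prime p → ¬ p ∣ N →
  ∃ λ d → 0 < d × d ≤ p × N ^ d ≡1mod p
∃[d≤p]N^d≡1mod {p} N p-prime p∤N
  with i , j , i<j , Nⁱ≡Nʲ ← pigeonhole (n<1+n p) (λ (i : Fin (suc p)) → (N ^ toℕ i) mod p)
  = d , m<n⇒0<n∸m i<j , ≤-trans (m∸n≤m (toℕ j) (toℕ i)) (s≤s⁻¹ (toℕ<n j))
  , %-cancelˡ-≡1mod (N ^ toℕ i) (N ^ d) p-prime (∤⇒∤^ (toℕ i) p-prime p∤N) Nⁱ%p≡Nⁱ⁺ᵈ%p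
  where
  d : ℕ
  d = toℕ j ∸ toℕ i
  Nⁱ%p≡Nⁱ⁺ᵈ%p : N ^ toℕ i % p ≡ (N ^ toℕ i * N ^ d) % p
  Nⁱ%p≡Nⁱ⁺ᵈ%p = begin
    N ^ toℕ i % p              ≡⟨ toℕ-fromℕ< (m%n<n (N ^ toℕ i) p) ⟨
    toℕ ((N ^ toℕ i) mod p)    ≡⟨ cong toℕ Nⁱ≡Nʲ ⟩
    toℕ ((N ^ toℕ j) mod p)    ≡⟨ toℕ-fromℕ< (m%n<n (N ^ toℕ j) p) ⟩
    N ^ toℕ j % p              ≡⟨ cong (λ e → N ^ e % p) (m+[n∸m]≡n (<⇒≤ i<j)) ⟨
    N ^ (toℕ i + d) % p        ≡⟨ cong (_% p) (^-distribˡ-+-* N (toℕ i) d) ⟩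
    (N ^ toℕ i * N ^ d) % p    ∎
    where open ≡-Reasoning

m≤n⇒m∣n! : ∀ {m n} → 0 < m → m ≤ n → m ∣ n !
m≤n⇒m∣n! {suc m} _ m≤n = ∣-trans (m∣m*n (m !)) (m≤n⇒m!∣n! m≤n)

^-!-≡1mod : ∀ {p} N .{{_ : NonZero p}} → Prime p → ¬ p ∣ N → N ^ (p !) ≡1mod p
^-!-≡1mod {p} N p-prime p∤N with d , 0<d , d≤p , Nᵈ≡1 ← ∃[d≤p]N^d≡1mod N p-prime p∤N
  with divides c p!≡c*d ← m≤n⇒m∣n! 0<d d≤p
  = subst (_≡1mod p) (trans (^-*-assoc N d c) (cong (N ^_) (trans (*-comm d c) (sym p!≡c*d))))
          (≡1mod-^ c Nᵈ≡1)

∣⇒∣^ : ∀ {d m} n .{{_ : NonZero n}} → d ∣ m → d ∣ m ^ n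
∣⇒∣^ {m = m} (suc n) d∣m = ∣m⇒∣m*n (m ^ n) d∣m

lemma4p2 : (p : ℕ) → Prime p → (H : Structure) → (k : ℕ) → (R : Relation H k) →
    MPPDefinable p H R → StrictlyMPPDefinable p H R
lemma4p2 p p-prime H k R (φ , φ-defines-R) = ψ , ψ-defines-R , strict
  where
  instance
    p≢0 : NonZero p
    p≢0 = prime⇒nonZero p-prime
    p>1 : NonTrivial p
    p>1 = prime⇒nonTrivial p-prime
    p!≢0 : NonZero (p !)
    p!≢0 = p !≢0
  ψ : MPPFormula H k
  ψ = φ ^ᶠ (p !)
  strict : ∀ a → R a → numExt ψ a ≡1mod p
  strict a Ra = subst (_≡1mod p) (sym (numExt-^ᶠ φ (p !) a))
    (^-!-≡1mod (numExt φ a) p-prime (Equivalence.to (φ-defines-R a) Ra))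
  ψ-defines-R : Defines p ψ R
  ψ-defines-R a = mk⇔ (λ Ra → ≡1mod⇒∤ (strict a Ra)) λ p∤#ψ →
    Equivalence.from (φ-defines-R a) λ p∣#φ →
      p∤#ψ (subst (p ∣_) (sym (numExt-^ᶠ φ (p !) a)) (∣⇒∣^ (p !) p∣#φ))
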